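{- Let $F_n$ be a free group of rank $n\ge2$ and let $N$ be a nontrivial normal subgroup of $F_n$. Then there exists an element $A\in N$ which has no root.
   Context: An element $A$ of a free group has a root if there exist an element $w$ and an integer $k$ with $k\neq\pm1$ such that $A=w^k$. -}

module Defs where

open import Data.Nat using (ℕ; zero; suc)
open import Data.Integer using (ℤ; +_; -[1+_])
open import Data.Fin using (Fin)
import Data.Fin.Properties as FinP
open import Data.Bool using (Bool; true; false; not)
import Data.Bool.Properties as BoolP
open import Data.Product using (_×_; _,_)
open import Data.Product.Properties using (≡-dec)
open import Data.List using (List; []; _∷_; _++_; reverse; map)
open import Relation.Nullary using (yes; no)
open import Relation.Binary.PropositionalEquality using (_≡_)

-- The free group F_n on generators x_0,…,x_{n-1}, realised as reduced words.
-- A letter (i , true) is x_i, a letter (i , false) is x_i⁻¹.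
Letter : ℕ → Set
Letter n = Fin n × Bool

Word : ℕ → Set
Word n = List (Letter n)

invLetter : ∀ {n} → Letter n → Letter n
invLetter (i , b) = (i , not b)

push : ∀ {n} → Letter n → Word n → Word n
push x [] = x ∷ []
push x (y ∷ ys) with ≡-dec FinP._≟_ BoolP._≟_ y (invLetter x)
... | yes _ = ys
... | no  _ = x ∷ y ∷ ys

reduce : ∀ {n} → Word n → Word n
reduce [] = []
reduce (x ∷ w) = push x (reduce w)

-- elements of F_n are exactly the reduced words
IsReduced : ∀ {n} → Word n → Set
IsReduced w = reduce w ≡ w

e : ∀ {n} → Word n
e = []

infixl 7 _·_
_·_ : ∀ {n} → Word n → Word n → Word n
w · v = reduce (w ++ v)

_⁻¹ : ∀ {n} → Word n → Word n
w ⁻¹ = reduce (reverse (map invLetter w))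

powℕ : ∀ {n} → Word n → ℕ → Word n
powℕ w zero = e
powℕ w (suc k) = w · powℕ w k

_^_ : ∀ {n} → Word n → ℤ → Word n
w ^ (+ k) = powℕ w k
w ^ -[1+ k ] = powℕ (w ⁻¹) (suc k)

record NormalSubgroup (n : ℕ) : Set₁ where
  field
    _∈N : Word n → Set
    ∈N-reduced : ∀ {w} → w ∈N → IsReduced w
    ∈N-e : e ∈N
    ∈N-· : ∀ {w v} → w ∈N → v ∈N → (w · v) ∈N
    ∈N-⁻¹ : ∀ {w} → w ∈N → (w ⁻¹) ∈N
    ∈N-conj : ∀ {w} (g : Word n) → IsReduced g → w ∈N → (g · w · g ⁻¹) ∈N

module Submission where

-- A cyclically reduced proper power is a literal repetition: a reduced u is c v c⁻¹ with v
-- cyclically reduced, so uᵏ = c vᵏ c⁻¹ without cancellation, and if uᵏ is cyclically reduced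
-- then c is empty.  Hence k divides the number of occurrences of every letter in uᵏ.
-- Given a nontrivial reduced w ∈ N, take a letter p cancelling neither against the last letter
-- of w nor, as p⁻¹, against its first letter, a letter f on another generator, and
-- S = p f^(M+1) p⁻¹.  Then w · S w S⁻¹ ∈ N is the cyclically reduced word A = w S w S⁻¹, in
-- which p occurs P = 2|w|ₚ + 2 times and, for a suitable M, f occurs 2|w|_f · P + 1 times; so
-- no k ≥ 2 divides all letter counts of A.

open import Defs
open import Data.Nat using (ℕ; zero; suc; _+_; _*_; _≤_; s≤s; z≤n)
open import Data.Nat.Properties using (≤-refl; ≤-trans; +-identityʳ; *-zeroʳ)
open import Data.Nat.Divisibility using (_∣_; _∣0; m∣m*n; ∣m⇒∣m*n; ∣m+n∣m⇒∣n; ∣1⇒≡1)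
open import Data.Nat.Tactic.RingSolver using (solve-∀)
open import Data.Integer using (ℤ; +_; -[1+_])
open import Data.Fin using (zero; punchIn)
open import Data.Fin.Properties using (punchInᵢ≢i)
import Data.Fin.Properties as FinP
open import Data.Bool using (true; false)
open import Data.Bool.Properties using (not-involutive)
import Data.Bool.Properties as BoolP
open import Data.Product using (∃; ∃₂; _×_; _,_; proj₁; proj₂)
open import Data.Product.Properties using (≡-dec)
open import Data.Sum using (_⊎_; inj₁; inj₂)
open import Data.Maybe using (just)
open import Data.Maybe.Relation.Binary.Connected using (Connected; just; drop-just)
open import Data.List
  using (List; []; _∷_; _++_; _∷ʳ_; reverse; map; replicate; concat; filter; length; head; last;
         initLast; _∷ʳ′_)
open import Data.List.Properties
  using (++-assoc; ++-identityʳ; length-++; length-++-≤ˡ; unfold-reverse; reverse-++; map-++; map-replicate;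
         filter-++; filter-accept; filter-reject)
open import Data.List.Relation.Unary.Linked using (Linked; []; [-]; _∷_; head′; tail)
import Data.List.Relation.Unary.Linked as Linked
open import Data.List.Relation.Unary.Linked.Properties using (++⁺)
open import Data.Empty using (⊥-elim)
open import Function using (_∘_)
open import Relation.Nullary using (¬_; yes; no)
open import Relation.Binary.Core using (Rel)
open import Relation.Binary.Definitions using (DecidableEquality)
open import Relation.Binary.PropositionalEquality

module _ {a} {A : Set a} where

  last-++ : ∀ (xs : List A) {y ys} → last (xs ++ y ∷ ys) ≡ last (y ∷ ys)
  last-++ []           = refl
  last-++ (_ ∷ [])     = refl
  last-++ (_ ∷ x ∷ xs) = last-++ (x ∷ xs)

  last-∷-just : ∀ (x : A) xs → ∃ λ z → last (x ∷ xs) ≡ just z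
  last-∷-just x []       = x , refl
  last-∷-just _ (x ∷ xs) = last-∷-just x xs

  replicate-∷ʳ : ∀ m (x : A) → replicate m x ∷ʳ x ≡ x ∷ replicate m x
  replicate-∷ʳ zero    x = refl
  replicate-∷ʳ (suc m) x = cong (x ∷_) (replicate-∷ʳ m x)

  reverse-replicate : ∀ m (x : A) → reverse (replicate m x) ≡ replicate m x
  reverse-replicate zero    x = refl
  reverse-replicate (suc m) x = begin
    reverse (x ∷ replicate m x)   ≡⟨ unfold-reverse x (replicate m x) ⟩
    reverse (replicate m x) ∷ʳ x   ≡⟨ cong (_∷ʳ x) (reverse-replicate m x) ⟩
    replicate m x ∷ʳ x             ≡⟨ replicate-∷ʳ m x ⟩
    x ∷ replicate m x             ∎
    where open ≡-Reasoning

module _ {a ℓ} {A : Set a} {R : Rel A ℓ} where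

  Linked-++⁻ : ∀ xs {ys} → Linked R (xs ++ ys) →
               Linked R xs × Linked R ys × Connected R (last xs) (head ys)
  Linked-++⁻ [] {[]}     r = [] , r , Connected.nothing
  Linked-++⁻ [] {_ ∷ _}  r = [] , r , Connected.nothing-just
  Linked-++⁻ (x ∷ [])     r = [-] , tail r , head′ r
  Linked-++⁻ (x ∷ y ∷ xs) (xy ∷ r) with Linked-++⁻ (y ∷ xs) r
  ... | rxs , rys , joint = xy ∷ rxs , rys , joint

module _ {n : ℕ} where

  invLetter-involutive : (x : Letter n) → invLetter (invLetter x) ≡ x
  invLetter-involutive (i , b) = cong (i ,_) (not-involutive b)

  invLetter-≢ : (x : Letter n) → invLetter x ≢ x
  invLetter-≢ (i , true)  ()
  invLetter-≢ (i , false) ()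

  invLetter-swap : {x y : Letter n} → x ≡ invLetter y → y ≡ invLetter x
  invLetter-swap {y = y} refl = sym (invLetter-involutive y)

  _≟L_ : DecidableEquality (Letter n)
  _≟L_ = ≡-dec FinP._≟_ BoolP._≟_

  infix 4 _↝_
  _↝_ : Rel (Letter n) _
  x ↝ y = y ≢ invLetter x

  Reduced : Word n → Set
  Reduced = Linked _↝_

  CyclicallyReduced : Word n → Set
  CyclicallyReduced w = Reduced w × Connected _↝_ (last w) (head w)

  push-cancel : ∀ {x y} ys → y ≡ invLetter x → push x (y ∷ ys) ≡ ys
  push-cancel {x} {y} ys y≡x⁻¹ with y ≟L invLetter x
  ... | yes _     = refl
  ... | no y≢x⁻¹ = ⊥-elim (y≢x⁻¹ y≡x⁻¹)

  push-keep : ∀ {x y} ys → x ↝ y → push x (y ∷ ys) ≡ x ∷ y ∷ ys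
  push-keep {x} {y} ys x↝y with y ≟L invLetter x
  ... | yes y≡x⁻¹ = ⊥-elim (x↝y y≡x⁻¹)
  ... | no _      = refl

  push-Reduced : ∀ x {w} → Reduced w → Reduced (push x w)
  push-Reduced x {[]}    _ = [-]
  push-Reduced x {y ∷ _} r with y ≟L invLetter x
  ... | yes _    = tail r
  ... | no x↝y   = x↝y ∷ r

  reduce-Reduced : (w : Word n) → Reduced (reduce w)
  reduce-Reduced []      = []
  reduce-Reduced (x ∷ w) = push-Reduced x (reduce-Reduced w)

  Reduced⇒IsReduced : {w : Word n} → Reduced w → IsReduced w
  Reduced⇒IsReduced []                   = refl
  Reduced⇒IsReduced [-]                  = refl
  Reduced⇒IsReduced {x ∷ y ∷ ys} (x↝y ∷ r)
    rewrite Reduced⇒IsReduced r = push-keep ys x↝y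

  IsReduced⇒Reduced : {w : Word n} → IsReduced w → Reduced w
  IsReduced⇒Reduced {w} eq = subst Reduced eq (reduce-Reduced w)

  push-invLetter-push : ∀ x {w} → Reduced w → push (invLetter x) (push x w) ≡ w
  push-invLetter-push x {[]} _ = push-cancel [] (sym (invLetter-involutive x))
  push-invLetter-push x {y ∷ ys} r with y ≟L invLetter x
  push-invLetter-push x {_ ∷ []}     _       | yes refl = refl
  push-invLetter-push x {_ ∷ z ∷ zs} (x↝z ∷ _) | yes refl = push-keep zs x↝z
  ... | no _ = push-cancel (y ∷ ys) (sym (invLetter-involutive x))

  reduce-++-cong : ∀ xs {ys zs : Word n} → reduce ys ≡ reduce zs → reduce (xs ++ ys) ≡ reduce (xs ++ zs)
  reduce-++-cong []       eq = eq
  reduce-++-cong (x ∷ xs) eq = cong (push x) (reduce-++-cong xs eq)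

  invWord : Word n → Word n
  invWord w = reverse (map invLetter w)

  invWord-∷ : ∀ x w → invWord (x ∷ w) ≡ invWord w ∷ʳ invLetter x
  invWord-∷ x w = unfold-reverse (invLetter x) (map invLetter w)

  invWord-++ : ∀ xs ys → invWord (xs ++ ys) ≡ invWord ys ++ invWord xs
  invWord-++ xs ys = trans (cong reverse (map-++ invLetter xs ys)) (reverse-++ (map invLetter xs) _)

  invWord-replicate : ∀ m x → invWord (replicate m x) ≡ replicate m (invLetter x)
  invWord-replicate m x =
    trans (cong reverse (map-replicate invLetter m x)) (reverse-replicate m (invLetter x))

  reduce-invWord-++ : ∀ c ys → reduce (invWord c ++ c ++ ys) ≡ reduce ys
  reduce-invWord-++ []      ys = refl
  reduce-invWord-++ (x ∷ c) ys = begin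
    reduce (invWord (x ∷ c) ++ x ∷ c ++ ys)
      ≡⟨ cong (λ v → reduce (v ++ x ∷ c ++ ys)) (invWord-∷ x c) ⟩
    reduce ((invWord c ∷ʳ invLetter x) ++ x ∷ c ++ ys)
      ≡⟨ cong reduce (++-assoc (invWord c) _ _) ⟩
    reduce (invWord c ++ invLetter x ∷ x ∷ c ++ ys)
      ≡⟨ reduce-++-cong (invWord c) (push-invLetter-push x (reduce-Reduced (c ++ ys))) ⟩
    reduce (invWord c ++ c ++ ys)
      ≡⟨ reduce-invWord-++ c ys ⟩
    reduce ys ∎
    where open ≡-Reasoning

  conjugate-∷ : ∀ x c m → (x ∷ c) ++ m ++ invWord (x ∷ c) ≡ x ∷ ((c ++ m ++ invWord c) ∷ʳ invLetter x)
  conjugate-∷ x c m = cong (x ∷_) (begin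
    c ++ m ++ invWord (x ∷ c)                 ≡⟨ cong (λ v → c ++ m ++ v) (invWord-∷ x c) ⟩
    c ++ m ++ (invWord c ∷ʳ invLetter x)       ≡⟨ cong (c ++_) (++-assoc m (invWord c) _) ⟨
    c ++ (m ++ invWord c) ∷ʳ invLetter x       ≡⟨ ++-assoc c (m ++ invWord c) _ ⟨
    (c ++ m ++ invWord c) ∷ʳ invLetter x       ∎)
    where open ≡-Reasoning

  conjugate-¬CyclicallyReduced : ∀ x c m → ¬ CyclicallyReduced ((x ∷ c) ++ m ++ invWord (x ∷ c))
  conjugate-¬CyclicallyReduced x c m cyc with subst CyclicallyReduced (conjugate-∷ x c m) cyc
  ... | _ , joint =
    drop-just (subst (λ l → Connected _↝_ l (just x)) (last-++ (x ∷ c ++ m ++ invWord c)) joint)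
              (sym (invLetter-involutive x))

  CyclicDecomposition : Word n → Set
  CyclicDecomposition u =
    ∃₂ λ c h → ∃ λ t → CyclicallyReduced (h ∷ t) × u ≡ c ++ (h ∷ t) ++ invWord c

  cyclicDecomposition : ∀ k u → length u ≤ k → Reduced u → u ≡ [] ⊎ CyclicDecomposition u
  cyclicDecomposition _       []      _       _ = inj₁ refl
  cyclicDecomposition (suc k) (x ∷ r) (s≤s ∣r∣≤k) red with initLast r
  ... | [] = inj₂ ([] , x , [] , ([-] , just (invLetter-≢ x ∘ sym)) , refl)
  ... | m ∷ʳ′ y with y ≟L invLetter x
  ...   | no y≢x⁻¹ = inj₂ ([] , x , m ∷ʳ y , (red , joint) , sym (++-identityʳ _))
    where
    joint : Connected _↝_ (last (x ∷ m ∷ʳ y)) (just x)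
    joint = subst (λ l → Connected _↝_ l (just x)) (sym (last-++ (x ∷ m)))
                  (just (y≢x⁻¹ ∘ invLetter-swap))
  ...   | yes refl with cyclicDecomposition k m (≤-trans (length-++-≤ˡ m) ∣r∣≤k)
                          (proj₁ (Linked-++⁻ m (tail red)))
  ...     | inj₁ refl = ⊥-elim (Linked.head red refl)
  ...     | inj₂ (c , h , t , cyc , refl) = inj₂ (x ∷ c , h , t , cyc , sym (conjugate-∷ x c (h ∷ t)))

  concat-replicate-Reduced : ∀ {h t ys} → CyclicallyReduced (h ∷ t) → Reduced ((h ∷ t) ++ ys) →
                             ∀ k → Reduced (concat (replicate (suc k) (h ∷ t)) ++ ys)
  concat-replicate-Reduced {h} {t} {ys} _ r zero =
    subst (λ v → Reduced (v ++ ys)) (sym (++-identityʳ (h ∷ t))) r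
  concat-replicate-Reduced {h} {t} {ys} cyc@(rv , joint) r (suc k) =
    subst Reduced (sym (++-assoc (h ∷ t) _ ys)) (++⁺ rv joint (concat-replicate-Reduced cyc r k))

  module _ c {h t} (cyc : CyclicallyReduced (h ∷ t)) (red : Reduced (c ++ (h ∷ t) ++ invWord c)) where

    conjugate-power-Reduced : ∀ k → Reduced (c ++ concat (replicate (suc k) (h ∷ t)) ++ invWord c)
    conjugate-power-Reduced k with Linked-++⁻ c red
    ... | rc , rvc , joint = ++⁺ rc joint (concat-replicate-Reduced cyc rvc k)

    powℕ-conjugate : ∀ k → powℕ (c ++ (h ∷ t) ++ invWord c) (suc k)
                           ≡ c ++ concat (replicate (suc k) (h ∷ t)) ++ invWord c
    powℕ-conjugate zero = begin
      reduce (u ++ [])          ≡⟨ cong reduce (++-identityʳ u) ⟩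
      reduce u                  ≡⟨ Reduced⇒IsReduced red ⟩
      c ++ v ++ c⁻              ≡⟨ cong (λ x → c ++ x ++ c⁻) (++-identityʳ v) ⟨
      c ++ (v ++ []) ++ c⁻      ∎
      where
      open ≡-Reasoning
      v = h ∷ t
      c⁻ = invWord c
      u = c ++ v ++ c⁻
    powℕ-conjugate (suc k) = begin
      reduce (u ++ powℕ u (suc k))
        ≡⟨ cong (λ x → reduce (u ++ x)) (powℕ-conjugate k) ⟩
      reduce (u ++ c ++ V ++ c⁻)
        ≡⟨ cong reduce (trans (++-assoc c (v ++ c⁻) _) (cong (c ++_) (++-assoc v c⁻ _))) ⟩
      reduce (c ++ v ++ c⁻ ++ c ++ V ++ c⁻)
        ≡⟨ reduce-++-cong c (reduce-++-cong v (reduce-invWord-++ c (V ++ c⁻))) ⟩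
      reduce (c ++ v ++ V ++ c⁻)
        ≡⟨ cong (λ x → reduce (c ++ x)) (++-assoc v V c⁻) ⟨
      reduce (c ++ (v ++ V) ++ c⁻)
        ≡⟨ Reduced⇒IsReduced (conjugate-power-Reduced (suc k)) ⟩
      c ++ (v ++ V) ++ c⁻ ∎
      where
      open ≡-Reasoning
      v = h ∷ t
      c⁻ = invWord c
      u = c ++ v ++ c⁻
      V = concat (replicate (suc k) v)

  powℕ-e : ∀ k → powℕ (e {n}) k ≡ e
  powℕ-e zero                     = refl
  powℕ-e (suc k) rewrite powℕ-e k = refl

  count : Letter n → Word n → ℕ
  count l w = length (filter (l ≟L_) w)

  count-++ : ∀ l xs ys → count l (xs ++ ys) ≡ count l xs + count l ys
  count-++ l xs ys = trans (cong length (filter-++ (l ≟L_) xs ys)) (length-++ (filter (l ≟L_) xs))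

  count-here : ∀ l w → count l (l ∷ w) ≡ suc (count l w)
  count-here l w = cong length (filter-accept (l ≟L_) refl)

  count-there : ∀ {l x} w → l ≢ x → count l (x ∷ w) ≡ count l w
  count-there {l} w l≢x = cong length (filter-reject (l ≟L_) l≢x)

  count-replicate : ∀ m x → count x (replicate m x) ≡ m
  count-replicate zero    x = refl
  count-replicate (suc m) x = trans (count-here x (replicate m x)) (cong suc (count-replicate m x))

  count-replicate-≢ : ∀ m {l x} → l ≢ x → count l (replicate m x) ≡ 0
  count-replicate-≢ zero    _   = refl
  count-replicate-≢ (suc m) l≢x = trans (count-there _ l≢x) (count-replicate-≢ m l≢x)

  count-concat-replicate : ∀ l k v → count l (concat (replicate k v)) ≡ k * count l v
  count-concat-replicate l zero    v = refl
  count-concat-replicate l (suc k) v =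
    trans (count-++ l v _) (cong (λ x → count l v + x) (count-concat-replicate l k v))

  cyclicallyReduced-power-count : ∀ {A u} → CyclicallyReduced A → Reduced u →
                                  ∀ k → A ≡ powℕ u (suc k) →
                                ∃ λ v → ∀ l → count l A ≡ suc k * count l v
  cyclicallyReduced-power-count {A} {u} cycA red k A≡uᵏ with cyclicDecomposition (length u) u ≤-refl red
  ... | inj₁ refl =
    [] , λ l → trans (cong (count l) (trans A≡uᵏ (powℕ-e (suc k)))) (sym (*-zeroʳ (suc k)))
  ... | inj₂ (x ∷ c , h , t , cyc , refl) =
    ⊥-elim (conjugate-¬CyclicallyReduced x c _
             (subst CyclicallyReduced (trans A≡uᵏ (powℕ-conjugate (x ∷ c) cyc red k)) cycA))
  ... | inj₂ ([] , h , t , cyc , refl) = h ∷ t , λ l → begin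
    count l A
      ≡⟨ cong (count l) (trans A≡uᵏ (powℕ-conjugate [] cyc red k)) ⟩
    count l (concat (replicate (suc k) (h ∷ t)) ++ [])
      ≡⟨ cong (count l) (++-identityʳ (concat (replicate (suc k) (h ∷ t)))) ⟩
    count l (concat (replicate (suc k) (h ∷ t)))
      ≡⟨ count-concat-replicate l (suc k) (h ∷ t) ⟩
    suc k * count l (h ∷ t) ∎
    where open ≡-Reasoning

  LetterCountsCoprime : Word n → Set
  LetterCountsCoprime A = ∀ d → (∀ l → d ∣ count l A) → d ≡ 1

  HasRoot : Word n → Set
  HasRoot A = ∃ λ (w : Word n) → ∃ λ (k : ℤ) → IsReduced w × k ≢ + 1 × k ≢ -[1+ 0 ] × A ≡ w ^ k

  LetterCountsCoprime⇒≢[] : ∀ {A} → LetterCountsCoprime A → A ≢ []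
  LetterCountsCoprime⇒≢[] coprime refl with coprime 2 (λ _ → 2 ∣0)
  ... | ()

  cyclicallyReduced-≢-powℕ : ∀ {A u} → CyclicallyReduced A → LetterCountsCoprime A → Reduced u →
                             ∀ k → A ≢ powℕ u (suc (suc k))
  cyclicallyReduced-≢-powℕ cyc coprime red k A≡uᵏ
    with v , count-A ← cyclicallyReduced-power-count cyc red (suc k) A≡uᵏ
    with coprime (suc (suc k)) (λ l → subst (suc (suc k) ∣_) (sym (count-A l)) (m∣m*n (count l v)))
  ... | ()

  cyclicallyReduced-¬HasRoot : ∀ {A} → CyclicallyReduced A → LetterCountsCoprime A → ¬ HasRoot A
  cyclicallyReduced-¬HasRoot _   coprime (w , + 0 , _ , _ , _ , A≡[]) = LetterCountsCoprime⇒≢[] coprime A≡[]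
  cyclicallyReduced-¬HasRoot _   _       (w , + 1 , _ , k≢1 , _ , _)  = k≢1 refl
  cyclicallyReduced-¬HasRoot cyc coprime (w , + suc (suc k) , w-red , _ , _ , A≡wᵏ) =
    cyclicallyReduced-≢-powℕ cyc coprime (IsReduced⇒Reduced w-red) k A≡wᵏ
  cyclicallyReduced-¬HasRoot _   _       (w , -[1+ 0 ] , _ , _ , k≢-1 , _) = k≢-1 refl
  cyclicallyReduced-¬HasRoot cyc coprime (w , -[1+ suc k ] , _ , _ , _ , A≡wᵏ) =
    cyclicallyReduced-≢-powℕ cyc coprime (reduce-Reduced (invWord w)) k A≡wᵏ

  sandwich : Letter n → Letter n → ℕ → Word n
  sandwich p g m = p ∷ replicate m g ++ invLetter p ∷ []

  last-sandwich : ∀ p g m → last (sandwich p g m) ≡ just (invLetter p)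
  last-sandwich p g m = last-++ (p ∷ replicate m g)

  invWord-sandwich : ∀ p g m → invWord (sandwich p g m) ≡ sandwich p (invLetter g) m
  invWord-sandwich p g m = begin
    invWord (p ∷ replicate m g ++ invLetter p ∷ [])
      ≡⟨ invWord-∷ p (replicate m g ++ invLetter p ∷ []) ⟩
    invWord (replicate m g ++ invLetter p ∷ []) ∷ʳ invLetter p
      ≡⟨ cong (_∷ʳ invLetter p) (invWord-++ (replicate m g) _) ⟩
    (invLetter (invLetter p) ∷ invWord (replicate m g)) ∷ʳ invLetter p
      ≡⟨ cong₂ (λ q r → (q ∷ r) ∷ʳ invLetter p) (invLetter-involutive p) (invWord-replicate m g) ⟩
    sandwich p (invLetter g) m ∎
    where open ≡-Reasoning

  module _ {p : Letter n} where

    sandwich-Reduced : ∀ {g} → proj₁ g ≢ proj₁ p → ∀ m → Reduced (sandwich p g (suc m))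
    sandwich-Reduced {g} g≁p m = (g≁p ∘ cong proj₁) ∷ middle m
      where
      middle : ∀ m → Reduced (replicate (suc m) g ++ invLetter p ∷ [])
      middle zero    = (g≁p ∘ sym ∘ cong proj₁) ∷ [-]
      middle (suc m) = (invLetter-≢ g ∘ sym) ∷ middle m

    count-sandwich-centre : ∀ {g} → proj₁ g ≢ proj₁ p → ∀ m → count p (sandwich p g m) ≡ 1
    count-sandwich-centre g≁p m = begin
      count p (sandwich p _ m)
        ≡⟨ count-here p _ ⟩
      suc (count p (replicate m _ ++ invLetter p ∷ []))
        ≡⟨ cong suc (count-++ p (replicate m _) _) ⟩
      suc (count p (replicate m _) + count p (invLetter p ∷ []))
        ≡⟨ cong₂ (λ x y → suc (x + y)) (count-replicate-≢ m (g≁p ∘ cong proj₁ ∘ sym))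
                                       (count-there [] (invLetter-≢ p ∘ sym)) ⟩
      1 ∎
      where open ≡-Reasoning

    count-sandwich : ∀ {l} → proj₁ l ≢ proj₁ p → ∀ g m →
                     count l (sandwich p g m) ≡ count l (replicate m g)
    count-sandwich {l} l≁p g m = begin
      count l (sandwich p g m)
        ≡⟨ count-there _ (l≁p ∘ cong proj₁) ⟩
      count l (replicate m g ++ invLetter p ∷ [])
        ≡⟨ count-++ l (replicate m g) _ ⟩
      count l (replicate m g) + count l (invLetter p ∷ [])
        ≡⟨ cong (λ x → count l (replicate m g) + x) (count-there [] (l≁p ∘ cong proj₁)) ⟩
      count l (replicate m g) + 0
        ≡⟨ +-identityʳ _ ⟩
      count l (replicate m g) ∎
      where open ≡-Reasoning

letter-avoiding : ∀ {n} (a b : Letter (suc (suc n))) → ∃ λ p → p ≢ a × p ≢ b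
letter-avoiding a b with (punchIn (proj₁ a) zero , true) ≟L b
... | yes refl = invLetter b , punchInᵢ≢i (proj₁ a) zero ∘ cong proj₁ , invLetter-≢ b
... | no x≢b   = _ , punchInᵢ≢i (proj₁ a) zero ∘ cong proj₁ , x≢b

∣m⇒∣m*n+1⇒≡1 : ∀ {d m} n → d ∣ m → d ∣ m * n + 1 → d ≡ 1
∣m⇒∣m*n+1⇒≡1 n d∣m d∣m*n+1 = ∣1⇒≡1 (∣m+n∣m⇒∣n d∣m*n+1 (∣m⇒∣m*n n d∣m))

multiplier-correct : ∀ cp cf →
  cf + (suc ((cp + (cp + 1)) * (cf + cf)) + (cf + 0)) ≡ (cp + (1 + (cp + 1))) * (cf + cf) + 1
multiplier-correct = solve-∀

module _ {n : ℕ} (N : NormalSubgroup (suc (suc n))) {a : Letter (suc (suc n))} {w′ : Word (suc (suc n))}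
         (w∈N : NormalSubgroup._∈N N (a ∷ w′)) where

  open NormalSubgroup N

  private
    w : Word (suc (suc n))
    w = a ∷ w′

    w-Reduced : Reduced w
    w-Reduced = IsReduced⇒Reduced (∈N-reduced w∈N)

    z = proj₁ (last-∷-just a w′)
    p = proj₁ (letter-avoiding a (invLetter z))
    p≢a = proj₁ (proj₂ (letter-avoiding a (invLetter z)))
    p≢z⁻¹ = proj₂ (proj₂ (letter-avoiding a (invLetter z)))

    f : Letter (suc (suc n))
    f = punchIn (proj₁ p) zero , true

    f≁p : proj₁ f ≢ proj₁ p
    f≁p = punchInᵢ≢i (proj₁ p) zero

    -- makes count f A = count p A * (2 * count f w) + 1
    M : ℕ
    M = (count p w + (count p w + 1)) * (count f w + count f w)

    S S′ A : Word (suc (suc n))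
    S  = sandwich p f (suc M)
    S′ = sandwich p (invLetter f) (suc M)
    A  = w ++ S ++ w ++ S′

    w↝p : Connected _↝_ (last w) (just p)
    w↝p = subst (λ l → Connected _↝_ l (just p)) (sym (proj₂ (last-∷-just a w′))) (just p≢z⁻¹)

    p⁻¹↝a : Connected _↝_ (just (invLetter p)) (just a)
    p⁻¹↝a = just λ a≡p⁻¹⁻¹ → p≢a (sym (trans a≡p⁻¹⁻¹ (invLetter-involutive p)))

    sandwich↝a : ∀ g → Connected _↝_ (last (sandwich p g (suc M))) (just a)
    sandwich↝a g = subst (λ l → Connected _↝_ l (just a)) (sym (last-sandwich p g (suc M))) p⁻¹↝a

    S-Reduced : Reduced S
    S-Reduced = sandwich-Reduced f≁p M

    S′-Reduced : Reduced S′
    S′-Reduced = sandwich-Reduced f≁p M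

    Sw-Reduced : Reduced (S ++ w)
    Sw-Reduced = ++⁺ S-Reduced (sandwich↝a f) w-Reduced

    SwS′-Reduced : Reduced (S ++ w ++ S′)
    SwS′-Reduced = ++⁺ S-Reduced (sandwich↝a f) (++⁺ w-Reduced w↝p S′-Reduced)

    A-Reduced : Reduced A
    A-Reduced = ++⁺ w-Reduced w↝p SwS′-Reduced

    last-A : last A ≡ just (invLetter p)
    last-A = begin
      last (w ++ S ++ w ++ S′)  ≡⟨ last-++ w ⟩
      last (S ++ w ++ S′)       ≡⟨ last-++ S ⟩
      last (w ++ S′)            ≡⟨ last-++ w ⟩
      last S′                   ≡⟨ last-sandwich p (invLetter f) (suc M) ⟩
      just (invLetter p)        ∎
      where open ≡-Reasoning

    A-CyclicallyReduced : CyclicallyReduced A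
    A-CyclicallyReduced = A-Reduced , subst (λ l → Connected _↝_ l (just a)) (sym last-A) p⁻¹↝a

    A≡w·SwS⁻¹ : w · (S · w · S ⁻¹) ≡ A
    A≡w·SwS⁻¹ = begin
      w · (S · w · S ⁻¹)           ≡⟨ cong (λ g → w · (S · w · reduce g)) (invWord-sandwich p f (suc M)) ⟩
      w · (S · w · reduce S′)      ≡⟨ cong (λ g → w · (S · w · g)) (Reduced⇒IsReduced S′-Reduced) ⟩
      w · (reduce (S ++ w) · S′)   ≡⟨ cong (λ g → w · (g · S′)) (Reduced⇒IsReduced Sw-Reduced) ⟩
      w · reduce ((S ++ w) ++ S′)  ≡⟨ cong (λ g → w · reduce g) (++-assoc S w S′) ⟩
      w · reduce (S ++ w ++ S′)    ≡⟨ cong (w ·_) (Reduced⇒IsReduced SwS′-Reduced) ⟩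
      reduce A                     ≡⟨ Reduced⇒IsReduced A-Reduced ⟩
      A                            ∎
      where open ≡-Reasoning

    A∈N : A ∈N
    A∈N = subst _∈N A≡w·SwS⁻¹ (∈N-· w∈N (∈N-conj S (Reduced⇒IsReduced S-Reduced) w∈N))

    count-A : ∀ l → count l A ≡ count l w + (count l S + (count l w + count l S′))
    count-A l = trans (count-++ l w _) (cong (λ x → count l w + x)
                (trans (count-++ l S _) (cong (λ x → count l S + x) (count-++ l w S′))))

    count-p-A : count p A ≡ count p w + (1 + (count p w + 1))
    count-p-A = trans (count-A p) (cong₂ (λ x y → count p w + (x + (count p w + y)))
      (count-sandwich-centre f≁p (suc M))
      (count-sandwich-centre f≁p (suc M)))

    count-f-A : count f A ≡ count f w + (suc M + (count f w + 0))
    count-f-A = trans (count-A f) (cong₂ (λ x y → count f w + (x + (count f w + y)))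
      (trans (count-sandwich f≁p f (suc M)) (count-replicate (suc M) f))
      (trans (count-sandwich f≁p (invLetter f) (suc M))
             (count-replicate-≢ (suc M) (invLetter-≢ f ∘ sym))))

    count-f-A-unit : count f A ≡ count p A * (count f w + count f w) + 1
    count-f-A-unit = trans count-f-A (trans (multiplier-correct (count p w) (count f w))
                                        (cong (λ P → P * (count f w + count f w) + 1) (sym count-p-A)))

    A-LetterCountsCoprime : LetterCountsCoprime A
    A-LetterCountsCoprime d d∣count =
      ∣m⇒∣m*n+1⇒≡1 (count f w + count f w) (d∣count p) (subst (d ∣_) count-f-A-unit (d∣count f))

  ∃-cyclicallyReduced-coprime-∈N : ∃ λ A → A ∈N × CyclicallyReduced A × LetterCountsCoprime A
  ∃-cyclicallyReduced-coprime-∈N = A , A∈N , A-CyclicallyReduced , A-LetterCountsCoprime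

lemma4p4 : (n : ℕ) → 2 ≤ n → (N : NormalSubgroup n) →
    (∃ λ (w : Word n) → NormalSubgroup._∈N N w × w ≢ e) →
    ∃ λ (A : Word n) → NormalSubgroup._∈N N A ×
      ¬ (∃ λ (w : Word n) → ∃ λ (k : ℤ) →
           IsReduced w × k ≢ + 1 × k ≢ -[1+ 0 ] × A ≡ w ^ k)
lemma4p4 (suc (suc n)) (s≤s (s≤s z≤n)) N ([] , _ , []≢e) = ⊥-elim ([]≢e refl)
lemma4p4 (suc (suc n)) (s≤s (s≤s z≤n)) N (a ∷ w , w∈N , _) =
  let A , A∈N , A-cyclic , A-coprime = ∃-cyclicallyReduced-coprime-∈N N w∈N in
  A , A∈N , cyclicallyReduced-¬HasRoot A-cyclic A-coprime
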